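{- Let $G\in\varepsilon_{13}$. Then no two cycles of $G$ intersect in a path $P_t$ with $t>0$ edges.
   Context: All graphs are finite, simple and connected. An Euler graph is a connected graph all of whose nodes have even degree. $\varepsilon_{13}$ is the class of Euler graphs in which every cycle has length $\equiv 1$ or $\equiv 3\pmod 4$ and which contain at least one cycle of each of these two kinds. -}

module Defs where

open import Data.Nat using (ℕ; _≤_; _∸_; _%_)
open import Data.Nat.Divisibility using (_∣_)
open import Data.Fin using (Fin)
open import Data.Bool using (Bool; true; false; if_then_else_)
open import Data.List using (List; []; _∷_; _++_; [_]; zip; drop; length; map)
open import Data.Nat.ListAction using (sum)
open import Data.List.Membership.Propositional using (_∈_)
open import Data.List.Relation.Unary.All using (All)
open import Data.List.Relation.Unary.Unique.Propositional using (Unique)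
open import Data.List.Base using (allFin)
open import Data.Product using (_×_; _,_; ∃; Σ)
open import Data.Sum using (_⊎_)
open import Function.Bundles using (_⇔_)
open import Relation.Binary.PropositionalEquality using (_≡_)

record Graph (n : ℕ) : Set where
  field
    adj    : Fin n → Fin n → Bool
    sym    : ∀ i j → adj i j ≡ adj j i
    irrefl : ∀ i → adj i i ≡ false

module _ {n : ℕ} (G : Graph n) where
  open Graph G

  Adj : Fin n → Fin n → Set
  Adj i j = adj i j ≡ true

  degree : Fin n → ℕ
  degree i = sum (map (λ j → if adj i j then 1 else 0) (allFin n))

  data Walk : Fin n → Fin n → Set where
    []  : ∀ {u} → Walk u u
    _∷_ : ∀ {u v w} → Adj u v → Walk v w → Walk u w

  Connected : Set
  Connected = ∀ u v → Walk u v

  Euler : Set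
  Euler = Connected × (∀ i → 2 ∣ degree i)

cycleEdges : ∀ {A : Set} → List A → List (A × A)
cycleEdges []       = []
cycleEdges (v ∷ vs) = zip (v ∷ vs) (vs ++ [ v ])

pathEdges : ∀ {A : Set} → List A → List (A × A)
pathEdges ps = zip ps (drop 1 ps)

EdgeIn : ∀ {A : Set} → A → A → List (A × A) → Set
EdgeIn x y es = ((x , y) ∈ es) ⊎ ((y , x) ∈ es)

module _ {n : ℕ} (G : Graph n) where

  IsCycle : List (Fin n) → Set
  IsCycle vs = Unique vs × (3 ≤ length vs)
             × All (λ e → Adj G (Data.Product.proj₁ e) (Data.Product.proj₂ e)) (cycleEdges vs)

  -- a path: distinct vertices, consecutive ones adjacent; it has (length ps ∸ 1) edges
  IsPath : List (Fin n) → Set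
  IsPath ps = Unique ps × All (λ e → Adj G (Data.Product.proj₁ e) (Data.Product.proj₂ e)) (pathEdges ps)

  InE13 : Set
  InE13 = Euler G
        × (∀ C → IsCycle C → (length C % 4 ≡ 1) ⊎ (length C % 4 ≡ 3))
        × (∃ λ C → IsCycle C × length C % 4 ≡ 1)
        × (∃ λ C → IsCycle C × length C % 4 ≡ 3)

IntersectIn : ∀ {n} → List (Fin n) → List (Fin n) → List (Fin n) → Set
IntersectIn C₁ C₂ P =
    (∀ x → ((x ∈ C₁) × (x ∈ C₂)) ⇔ (x ∈ P))
  × (∀ x y → (EdgeIn x y (cycleEdges C₁) × EdgeIn x y (cycleEdges C₂)) ⇔ EdgeIn x y (pathEdges P))

-- Suppose C₁ ∩ C₂ is a path containing the edge p₀p₁.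
-- Leave p₀ along C₁ in the direction away from p₁ until C₁ first returns to C₂, at v. This ear
-- of C₂ and the two arcs of C₂ between p₀ and v form a theta graph: three internally disjoint
-- p₀–v paths with t + 1, b + 1 and d + 1 edges. Its three cycles have lengths b + d + 2,
-- t + b + 2 and t + d + 2, whose sum is even, so they cannot all be odd.
module Submission where

open import Defs
open import Data.Nat using (ℕ; suc; _+_; _*_; _%_; _≤_; s≤s; s≤s⁻¹; z≤n)
open import Data.Nat.Properties using (1+n≢0)
open import Data.Nat.DivMod using (%-distribˡ-+; m*n%n≡0; m∣n⇒o%n%m≡o%m)
open import Data.Nat.Divisibility using (divides)
open import Data.Nat.Tactic.RingSolver using (solve-∀)
open import Data.Fin using (Fin; _≟_)
open import Data.List using (List; []; _∷_; _++_; [_]; _∷ʳ_; length; reverse; zip)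
open import Data.List.Properties
  using (∷-injectiveˡ; length-++; length-++-sucʳ; length-reverse; unfold-reverse; reverse-++;
         ++-assoc)
open import Data.List.Membership.Propositional using (_∈_; _∉_)
open import Data.List.Membership.Propositional.Properties using (∈-∃++; ∈-++⁺ˡ; ∈-++⁺ʳ)
open import Data.List.Relation.Unary.Any using (here; there; any?)
open import Data.List.Relation.Unary.All as All using (All; []; _∷_)
open import Data.List.Relation.Unary.All.Properties using (++⁻ˡ)
open import Data.List.Relation.Unary.First as First using (FirstView)
open import Data.List.Relation.Unary.First.Properties using (toView)
open import Data.List.Relation.Unary.Unique.Propositional using (Unique; []; _∷_)
open import Data.List.Relation.Unary.Unique.Propositional.Properties using (++⁺; Unique[x∷xs]⇒x∉xs)
open import Data.List.Relation.Binary.Disjoint.Propositional using (Disjoint)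
open import Data.List.Relation.Binary.Permutation.Propositional
  using (_↭_; ↭-refl; ↭-sym; ↭-trans; ↭-prep; ↭⇒↭ₛ)
open import Data.List.Relation.Binary.Permutation.Propositional.Properties
  using (∈-resp-↭; ↭-length; ↭-reverse; ++-comm)
import Data.List.Relation.Binary.Permutation.Setoid.Properties as PermutationSetoid
open import Data.Product using (_×_; _,_; ∃; ∃₂; proj₁; proj₂)
open import Data.Sum as Sum using (_⊎_; inj₁; inj₂; swap)
open import Data.Empty using (⊥; ⊥-elim)
open import Function.Base using (_∘_)
open import Function.Bundles using (Equivalence)
open import Relation.Binary.PropositionalEquality
  using (_≡_; _≢_; refl; sym; trans; cong; cong₂; subst; setoid; module ≡-Reasoning)
open import Relation.Nullary using (¬_; yes; no; contradiction)
open import Relation.Nullary.Decidable using (toSum)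

Chain : ∀ {A : Set} → (A → A → Set) → A → List A → A → Set
Chain E a []       b = E a b
Chain E a (x ∷ xs) b = E a x × Chain E x xs b

module _ {A : Set} {E F : A → A → Set} where

  Chain-map : (∀ {x y} → E x y → F x y) → ∀ {a b} xs → Chain E a xs b → Chain F a xs b
  Chain-map f []       e        = f e
  Chain-map f (x ∷ xs) (e , es) = f e , Chain-map f xs es

module _ {A : Set} {E : A → A → Set} where

  Chain-++⁻ : ∀ {a b c ys} xs → Chain E a (xs ++ b ∷ ys) c → Chain E a xs b × Chain E b ys c
  Chain-++⁻ []       (e , es) = e , es
  Chain-++⁻ (x ∷ xs) (e , es) = let (es₁ , es₂) = Chain-++⁻ xs es in (e , es₁) , es₂

  Chain-++⁺ : ∀ {a b c ys} xs → Chain E a xs b → Chain E b ys c → Chain E a (xs ++ b ∷ ys) c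
  Chain-++⁺ []       e        es₂ = e , es₂
  Chain-++⁺ (x ∷ xs) (e , es₁) es₂ = e , Chain-++⁺ xs es₁ es₂

  Chain-reverse : (∀ {x y} → E x y → E y x) → ∀ {a b} xs → Chain E a xs b → Chain E b (reverse xs) a
  Chain-reverse sym-E []       e = sym-E e
  Chain-reverse sym-E (x ∷ xs) (e , es) rewrite unfold-reverse x xs =
    Chain-++⁺ (reverse xs) (Chain-reverse sym-E xs es) (sym-E e)

  Chain⇒All-zip : ∀ a xs b → Chain E a xs b →
                  All (λ e → E (proj₁ e) (proj₂ e)) (zip (a ∷ xs) (xs ++ [ b ]))
  Chain⇒All-zip a []       b e        = e ∷ []
  Chain⇒All-zip a (x ∷ xs) b (e , es) = e ∷ Chain⇒All-zip x xs b es

module _ {A : Set} where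

  zip-Chain : ∀ (a : A) xs b → Chain (λ x y → (x , y) ∈ zip (a ∷ xs) (xs ++ [ b ])) a xs b
  zip-Chain a []       b = here refl
  zip-Chain a (x ∷ xs) b = here refl , Chain-map there xs (zip-Chain x xs b)

  ∈-zip⁻ : ∀ {a b : A} xs ys → (a , b) ∈ zip xs ys → a ∈ xs × b ∈ ys
  ∈-zip⁻ (x ∷ xs) (y ∷ ys) (here refl) = here refl , here refl
  ∈-zip⁻ (x ∷ xs) (y ∷ ys) (there m)   = let (m₁ , m₂) = ∈-zip⁻ xs ys m in there m₁ , there m₂

  Unique-++⁻ˡ : ∀ {ys : List A} xs → Unique (xs ++ ys) → Unique xs
  Unique-++⁻ˡ []       _         = []
  Unique-++⁻ˡ (x ∷ xs) (x∉ ∷ u) = ++⁻ˡ xs x∉ ∷ Unique-++⁻ˡ xs u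

  Unique-++-∷⇒∉ : ∀ {x : A} {ys} xs → Unique (xs ++ x ∷ ys) → x ∉ xs
  Unique-++-∷⇒∉ (y ∷ xs) (y∉ ∷ u) (here refl) = All.lookup y∉ (∈-++⁺ʳ xs (here refl)) refl
  Unique-++-∷⇒∉ (y ∷ xs) (y∉ ∷ u) (there m)   = Unique-++-∷⇒∉ xs u m

  Unique-↭ : ∀ {xs ys : List A} → xs ↭ ys → Unique xs → Unique ys
  Unique-↭ p = PermutationSetoid.Unique-resp-↭ (setoid A) (↭⇒↭ₛ p)

  reverse-++-∷ : ∀ xs (y : A) ys → reverse (xs ++ y ∷ ys) ≡ reverse ys ++ y ∷ reverse xs
  reverse-++-∷ xs y ys = begin
    reverse (xs ++ y ∷ ys)             ≡⟨ reverse-++ xs (y ∷ ys) ⟩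
    reverse (y ∷ ys) ++ reverse xs     ≡⟨ cong (_++ reverse xs) (unfold-reverse y ys) ⟩
    (reverse ys ∷ʳ y) ++ reverse xs    ≡⟨ ++-assoc (reverse ys) [ y ] (reverse xs) ⟩
    reverse ys ++ y ∷ reverse xs       ∎
    where open ≡-Reasoning

  pathEdges-head : ∀ {p₀ p₁ y : A} {ps} → Unique (p₀ ∷ p₁ ∷ ps) →
                   EdgeIn p₀ y (pathEdges (p₀ ∷ p₁ ∷ ps)) → y ≡ p₁
  pathEdges-head u (inj₁ (here refl)) = refl
  pathEdges-head u (inj₁ (there m))   = ⊥-elim (Unique[x∷xs]⇒x∉xs u (proj₁ (∈-zip⁻ _ _ m)))
  pathEdges-head u (inj₂ (here refl)) = ⊥-elim (Unique[x∷xs]⇒x∉xs u (here refl))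
  pathEdges-head u (inj₂ (there m))   = ⊥-elim (Unique[x∷xs]⇒x∉xs u (there (proj₂ (∈-zip⁻ _ _ m))))

%4≡1⊎3⇒%2≡1 : ∀ m → m % 4 ≡ 1 ⊎ m % 4 ≡ 3 → m % 2 ≡ 1
%4≡1⊎3⇒%2≡1 m h = trans (sym (m∣n⇒o%n%m≡o%m 2 4 m (divides 2 refl))) (mod2 h)
  where
    mod2 : m % 4 ≡ 1 ⊎ m % 4 ≡ 3 → m % 4 % 2 ≡ 1
    mod2 (inj₁ e) = cong (_% 2) e
    mod2 (inj₂ e) = cong (_% 2) e

[x+y+z]%2≡1 : ∀ x y z → x % 2 ≡ 1 → y % 2 ≡ 1 → z % 2 ≡ 1 → (x + y + z) % 2 ≡ 1
[x+y+z]%2≡1 x y z hx hy hz = begin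
  (x + y + z) % 2                    ≡⟨ %-distribˡ-+ (x + y) z 2 ⟩
  ((x + y) % 2 + z % 2) % 2          ≡⟨ cong (λ s → (s + z % 2) % 2) (%-distribˡ-+ x y 2) ⟩
  ((x % 2 + y % 2) % 2 + z % 2) % 2  ≡⟨ cong₂ (λ a b → ((a + b) % 2 + z % 2) % 2) hx hy ⟩
  (0 + z % 2) % 2                    ≡⟨ cong (_% 2) hz ⟩
  1                                  ∎
  where open ≡-Reasoning

theta-not-all-odd : ∀ t b d →
  (suc b + suc d) % 2 ≡ 1 → (suc t + suc b) % 2 ≡ 1 → (suc t + suc d) % 2 ≡ 1 → ⊥
theta-not-all-odd t b d h₁ h₂ h₃ = 1+n≢0 (begin
  1                          ≡⟨ sym ([x+y+z]%2≡1 x y z h₁ h₂ h₃) ⟩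
  (x + y + z) % 2            ≡⟨ cong (_% 2) (sum≡double t b d) ⟩
  ((t + b + d + 3) * 2) % 2  ≡⟨ m*n%n≡0 (t + b + d + 3) 2 ⟩
  0                          ∎)
  where
    open ≡-Reasoning
    x y z : ℕ
    x = suc b + suc d
    y = suc t + suc b
    z = suc t + suc d
    sum≡double : ∀ t b d → suc b + suc d + (suc t + suc b) + (suc t + suc d) ≡ (t + b + d + 3) * 2
    sum≡double = solve-∀

module _ {n : ℕ} (G : Graph n) where

  CycleEdge : List (Fin n) → Fin n → Fin n → Set
  CycleEdge C x y = EdgeIn x y (cycleEdges C)

  CycleEdge-sym : ∀ {C x y} → CycleEdge C x y → CycleEdge C y x
  CycleEdge-sym (inj₁ m) = inj₂ m
  CycleEdge-sym (inj₂ m) = inj₁ m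

  CycleEdge⇒Adj : ∀ {C x y} → IsCycle G C → CycleEdge C x y → Adj G x y
  CycleEdge⇒Adj (_ , _ , adj) (inj₁ m) = All.lookup adj m
  CycleEdge⇒Adj {x = x} {y} (_ , _ , adj) (inj₂ m) = trans (Graph.sym G x y) (All.lookup adj m)

  AllCyclesOdd : Set
  AllCyclesOdd = ∀ C → IsCycle G C → length C % 2 ≡ 1

  -- C read cyclically from p is p ∷ R
  record Traversal (C : List (Fin n)) (p : Fin n) (R : List (Fin n)) : Set where
    field
      perm  : C ↭ p ∷ R
      chain : Chain (CycleEdge C) p R p
  open Traversal

  traversal : ∀ {C p} → p ∈ C → ∃ (Traversal C p)
  traversal {c ∷ cs} (here refl) = cs , record
    { perm = ↭-refl ; chain = Chain-map inj₁ cs (zip-Chain c cs c) }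
  traversal {c ∷ cs} {p} (there p∈cs) with A , B , refl ← ∈-∃++ p∈cs =
    B ++ c ∷ A , record
      { perm = ++-comm (c ∷ A) (p ∷ B) ; chain = Chain-++⁺ B (proj₂ arcs) (proj₁ arcs) }
    where
      arcs : Chain (CycleEdge (c ∷ A ++ p ∷ B)) c A p × Chain (CycleEdge (c ∷ A ++ p ∷ B)) p B c
      arcs = Chain-++⁻ A (Chain-map inj₁ (A ++ p ∷ B) (zip-Chain c (A ++ p ∷ B) c))

  Traversal-reverse : ∀ {C p R} → Traversal C p R → Traversal C p (reverse R)
  Traversal-reverse {C} {p} {R} t = record
    { perm  = ↭-trans (perm t) (↭-prep p (↭-sym (↭-reverse R)))
    ; chain = Chain-reverse (CycleEdge-sym {C}) R (chain t) }

  Traversal-unique : ∀ {C p R} → IsCycle G C → Traversal C p R → Unique (p ∷ R)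
  Traversal-unique (unique , _) t = Unique-↭ (perm t) unique

  Traversal-⊆ : ∀ {C p R x} → Traversal C p R → x ∈ p ∷ R → x ∈ C
  Traversal-⊆ t = ∈-resp-↭ (↭-sym (perm t))

  Traversal-⊇ : ∀ {C p R x} → Traversal C p R → x ∈ C → x ∈ p ∷ R
  Traversal-⊇ t = ∈-resp-↭ (perm t)

  Traversal-length : ∀ {C p R} → Traversal C p R → length C ≡ suc (length R)
  Traversal-length t = ↭-length (perm t)

  Traversal-length≥2 : ∀ {C p R} → IsCycle G C → Traversal C p R → 2 ≤ length R
  Traversal-length≥2 (_ , 3≤length , _) t = s≤s⁻¹ (subst (3 ≤_) (Traversal-length t) 3≤length)

  traversal-avoiding : ∀ {C p} → IsCycle G C → p ∈ C → ∀ y →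
                       ∃₂ λ r R → Traversal C p (r ∷ R) × r ≢ y
  traversal-avoiding c p∈C y with traversal p∈C
  ... | []        , t = contradiction (Traversal-length≥2 c t) λ ()
  ... | _ ∷ []    , t = contradiction (Traversal-length≥2 c t) λ { (s≤s ()) }
  ... | r ∷ s ∷ R , t with r ≟ y
  ...   | no r≢y = r , s ∷ R , t , r≢y
  ...   | yes refl with reverse (s ∷ R) in eq
  ...     | [] = contradiction (trans (sym (length-reverse (s ∷ R))) (cong length eq)) λ ()
  ...     | q ∷ Q = q , Q ∷ʳ r , subst (Traversal _ _) reversed (Traversal-reverse t) , q≢r
    where
      reversed : reverse (r ∷ s ∷ R) ≡ q ∷ Q ∷ʳ r
      reversed = trans (unfold-reverse r (s ∷ R)) (cong (_∷ʳ r) eq)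
      q∈sR : q ∈ s ∷ R
      q∈sR = ∈-resp-↭ (↭-reverse (s ∷ R)) (subst (q ∈_) (sym eq) (here refl))
      q≢r : q ≢ r
      q≢r refl with _ ∷ u ← Traversal-unique c t = Unique[x∷xs]⇒x∉xs u q∈sR

  glue-cycle : ∀ {p v T B} → Chain (Adj G) p T v → Chain (Adj G) v B p →
               Unique (p ∷ T) → Unique (v ∷ B) → Disjoint (p ∷ T) (v ∷ B) →
               (T ≡ [] → B ≢ []) → IsCycle G (p ∷ T ++ v ∷ B)
  glue-cycle {p} {v} {T} {B} pT pB uT uB disjoint nontrivial =
    ++⁺ uT uB disjoint , 3≤length T B nontrivial ,
    Chain⇒All-zip p (T ++ v ∷ B) p (Chain-++⁺ T pT pB)
    where
      3≤length : ∀ T B → (T ≡ [] → B ≢ []) → 3 ≤ length (p ∷ T ++ v ∷ B)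
      3≤length []      []      nt = contradiction refl (nt refl)
      3≤length []      (_ ∷ _) _  = s≤s (s≤s (s≤s z≤n))
      3≤length (_ ∷ T) B       _  rewrite length-++-sucʳ T v B = s≤s (s≤s (s≤s z≤n))

  record Ear (C : List (Fin n)) (p : Fin n) (T : List (Fin n)) (v : Fin n) : Set where
    field
      p∈C      : p ∈ C
      v∈C      : v ∈ C
      p≢v      : p ≢ v
      path     : Chain (Adj G) p T v
      unique   : Unique (p ∷ T)
      outside  : All (_∉ C) T
      not-edge : T ≡ [] → ¬ CycleEdge C p v

  module _ {C : List (Fin n)} (c : IsCycle G C) where

    ear-cycle : ∀ {p v T B D} → Ear C p T v → Traversal C v (B ++ p ∷ D) →
                IsCycle G (p ∷ T ++ v ∷ B)
    ear-cycle {p} {v} {T} {B} {D} e t =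
      glue-cycle (Ear.path e) (Chain-map (CycleEdge⇒Adj c) B (proj₁ (Chain-++⁻ B (chain t))))
                 (Ear.unique e) (Unique-++⁻ˡ (v ∷ B) uVBpD) disjoint nontrivial
      where
        uVBpD : Unique (v ∷ B ++ p ∷ D)
        uVBpD = Traversal-unique c t
        disjoint : Disjoint (p ∷ T) (v ∷ B)
        disjoint (here refl , x∈vB) = Unique-++-∷⇒∉ (v ∷ B) uVBpD x∈vB
        disjoint (there x∈T , x∈vB) =
          All.lookup (Ear.outside e) x∈T (Traversal-⊆ t (∈-++⁺ˡ x∈vB))
        nontrivial : T ≡ [] → B ≢ []
        nontrivial T≡[] refl = Ear.not-edge e T≡[] (CycleEdge-sym {C} (proj₁ (chain t)))

    AllCyclesOdd⇒¬Ear : AllCyclesOdd → ∀ {p v T} → ¬ Ear C p T v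
    AllCyclesOdd⇒¬Ear odd {p} {v} {T} e
      with R , t ← traversal (Ear.v∈C e)
      with Traversal-⊇ t (Ear.p∈C e)
    ... | here p≡v = Ear.p≢v e p≡v
    ... | there p∈R with B , D , refl ← ∈-∃++ p∈R =
      theta-not-all-odd (length T) (length B) (length D)
        (subst (λ k → k % 2 ≡ 1) (trans (Traversal-length t) (cong suc (length-++ B))) (odd C c))
        (odd-ear-cycle t)
        (subst (λ k → (suc (length T) + suc k) % 2 ≡ 1) (length-reverse D)
          (odd-ear-cycle (subst (Traversal C v) (reverse-++-∷ B p D) (Traversal-reverse t))))
      where
        odd-ear-cycle : ∀ {B D} → Traversal C v (B ++ p ∷ D) →
                        (suc (length T) + suc (length B)) % 2 ≡ 1
        odd-ear-cycle t′ = subst (λ k → k % 2 ≡ 1) (cong suc (length-++ T)) (odd _ (ear-cycle e t′))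

  AllCyclesOdd⇒¬IntersectIn : AllCyclesOdd → ∀ {C₁ C₂ P} → IsCycle G C₁ → IsCycle G C₂ →
                              IsPath G P → 2 ≤ length P → ¬ IntersectIn C₁ C₂ P
  AllCyclesOdd⇒¬IntersectIn odd {P = []}     _ _ _ () _
  AllCyclesOdd⇒¬IntersectIn odd {P = _ ∷ []} _ _ _ (s≤s ()) _
  AllCyclesOdd⇒¬IntersectIn odd {C₁} {C₂} {p₀ ∷ p₁ ∷ ps} c₁ c₂ (uP , _) _
                            (vertices , edges)
    with p₀∈C₁ , p₀∈C₂ ← Equivalence.from (vertices p₀) (here refl)
    with p₁∈C₁ , p₁∈C₂ ← Equivalence.from (vertices p₁) (there (here refl))
    with r , R , t , r≢p₁ ← traversal-avoiding c₁ p₀∈C₁ p₁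
    = no-first-return t (r≢p₁ ∘ ∷-injectiveˡ)
        (Sum.map₁ toView (First.first (λ x → swap (toSum (any? (x ≟_) C₂))) (r ∷ R)))
    where
      no-first-return : ∀ {L} → Traversal C₁ p₀ L → (∀ {W} → L ≢ p₁ ∷ W) →
                        FirstView (_∉ C₂) (_∈ C₂) L ⊎ All (_∉ C₂) L → ⊥
      no-first-return t _ (inj₂ outside) with Traversal-⊇ t p₁∈C₁
      ... | here p₁≡p₀ = Unique[x∷xs]⇒x∉xs uP (here (sym p₁≡p₀))
      ... | there p₁∈L = All.lookup outside p₁∈L p₁∈C₂
      no-first-return t not-p₁ (inj₁ (First._++_∷_ {xs = T} {y = v} outside v∈C₂ W)) =
        AllCyclesOdd⇒¬Ear c₂ odd record
          { p∈C = p₀∈C₂ ; v∈C = v∈C₂ ; p≢v = p₀≢v ; path = pT ; unique = Unique-++⁻ˡ (p₀ ∷ T) u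
          ; outside = outside ; not-edge = not-edge }
        where
          u : Unique (p₀ ∷ T ++ v ∷ W)
          u = Traversal-unique c₁ t
          p₀≢v : p₀ ≢ v
          p₀≢v p₀≡v = Unique-++-∷⇒∉ (p₀ ∷ T) u (here (sym p₀≡v))
          pT : Chain (Adj G) p₀ T v
          pT = Chain-map (CycleEdge⇒Adj c₁) T (proj₁ (Chain-++⁻ T (chain t)))
          -- an edge p₀v common to C₁ and C₂ lies on P, so v would be p₁
          not-edge : T ≡ [] → ¬ CycleEdge C₂ p₀ v
          not-edge refl e₂ = not-p₁ (cong (_∷ W)
            (pathEdges-head uP (Equivalence.to (edges p₀ v) (proj₁ (chain t) , e₂))))

theorem20 : ∀ {n : ℕ} (G : Graph n) → InE13 G →
            ∀ (C₁ C₂ P : List (Fin n)) → IsCycle G C₁ → IsCycle G C₂ →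
            IsPath G P → 2 ≤ length P → ¬ IntersectIn C₁ C₂ P
theorem20 G (_ , cycles≡1or3mod4 , _) C₁ C₂ P =
  AllCyclesOdd⇒¬IntersectIn G (λ C c → %4≡1⊎3⇒%2≡1 (length C) (cycles≡1or3mod4 C c))
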